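{- Let $n,d_h$ be positive integers and let $C_{n,d_h}$ be the graph on vertices $u_0,\dots,u_{n-1}$ in which two distinct vertices $u_i,u_j$ are adjacent iff $j\equiv i+t \pmod n$ or $j\equiv i-t\pmod n$ for some $t\in\{1,\dots,d_h\}$. Then $C_{n,d_h}$ is a connected VC-irreducible graph if and only if either $n\le 2d_h+1$ or $n-d_h$ is a multiple of $d_h+1$.
   Context: A vertex cover is a set of vertices meeting every edge. A connected graph $G=(V,E)$ is VC-irreducible if for every edge $e\in E$ the graph $(V,E\setminus\{e\})$ has strictly smaller minimum vertex cover size than $G$. -}

module Defs where

open import Data.Nat using (ℕ; suc; _+_; _<_; _≤_; _%_; NonZero)
open import Data.Fin using (Fin; toℕ)
open import Data.Fin.Subset using (Subset; _∈_; ∣_∣)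
open import Data.Product using (Σ; ∃; _×_; _,_)
open import Data.Sum using (_⊎_)
open import Relation.Nullary using (¬_)
open import Relation.Binary.PropositionalEquality using (_≡_; _≢_)

record Graph (n : ℕ) : Set₁ where
  field
    Adj : Fin n → Fin n → Set
open Graph public

Edge : {n : ℕ} → Graph n → Set
Edge {n} G = Σ (Fin n) λ a → Σ (Fin n) λ b → Adj G a b

SamePair : {n : ℕ} → Fin n → Fin n → Fin n → Fin n → Set
SamePair x y a b = (x ≡ a × y ≡ b) ⊎ (x ≡ b × y ≡ a)

deleteEdge : {n : ℕ} (G : Graph n) → Edge G → Graph n
deleteEdge G (a , b , _) = record { Adj = λ x y → Adj G x y × ¬ SamePair x y a b }

IsVertexCover : {n : ℕ} → Graph n → Subset n → Set
IsVertexCover G S = ∀ x y → Adj G x y → (x ∈ S) ⊎ (y ∈ S)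

IsMinVCSize : {n : ℕ} → Graph n → ℕ → Set
IsMinVCSize {n} G k =
  (Σ (Subset n) λ S → IsVertexCover G S × ∣ S ∣ ≡ k) ×
  (∀ (S : Subset n) → IsVertexCover G S → k ≤ ∣ S ∣)

data Reachable {n : ℕ} (G : Graph n) : Fin n → Fin n → Set where
  here : ∀ {x} → Reachable G x x
  step : ∀ {x y z} → Adj G x y → Reachable G y z → Reachable G x z

Connected : {n : ℕ} → Graph n → Set
Connected {n} G = ∀ (x y : Fin n) → Reachable G x y

IsVCIrreducible : {n : ℕ} → Graph n → Set
IsVCIrreducible G =
  Connected G ×
  (∀ (e : Edge G) (k k' : ℕ) → IsMinVCSize G k → IsMinVCSize (deleteEdge G e) k' → k' < k)

-- The circulant graph C_{n,d}: u_i ~ u_j iff i ≠ j and, for some t ∈ {1..d},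
-- j ≡ i + t (mod n) or j ≡ i - t (mod n)  (the latter written i ≡ j + t (mod n)).
CircAdj : (n d : ℕ) → .{{NonZero n}} → Fin n → Fin n → Set
CircAdj n d i j =
  i ≢ j ×
  ∃ λ t → 1 ≤ t × t ≤ d ×
    ((toℕ j ≡ (toℕ i + t) % n) ⊎ (toℕ i ≡ (toℕ j + t) % n))

C : (n d : ℕ) → .{{NonZero n}} → Graph n
C n d = record { Adj = CircAdj n d }

-- Minimum vertex covers are complements of maximum independent sets, so everything reduces to
-- the independence number α.  An independent set of C n d is d-spaced around the cycle, each of
-- its points claiming d + 1 consecutive slots, so α (d + 1) ≤ n; with n = q (d + 1) + r the
-- multiples of d + 1 show α = q.  Deleting the edge {0, d} permits one pair at distance d, and the
-- slot count improves only to α (d + 1) ≤ n + 1, which keeps α = q (hence the same cover number)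
-- unless r = d.  If r = d, every edge {u, u + t} is critical: u, u + t, u + t + (d + 1), … is an
-- independent set of size q + 1 once that edge is gone.  If n ≤ 2d + 1, any two vertices are
-- adjacent, so α = 1, while the endpoints of a deleted edge become independent.

module Submission where

open import Data.Bool using (Bool; true; false; not; _∨_)
import Data.Bool.Properties as Bool
open import Data.Empty using (⊥; ⊥-elim)
open import Data.Fin using (Fin; toℕ; fromℕ<) renaming (zero to fzero; suc to fsuc)
open import Data.Fin.Properties using (toℕ<n; toℕ-fromℕ<; fromℕ<-toℕ; fromℕ<-injective; toℕ-injective)
open import Data.Fin.Subset using (Subset; _∈_; ∣_∣)
open import Data.Nat
  using ( ℕ; zero; suc; _+_; _*_; _∸_; _≤_; _<_; _≡ᵇ_; _≤?_; _<?_; _≟_; z≤n; s≤s; s≤s⁻¹; z<s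
        ; NonZero; >-nonZero⁻¹)
open import Data.Nat.DivMod
  using (_%_; _/_; m≡m%n+[m/n]*n; m%n<n; m/n*n≤m; %-distribˡ-+; m%n%n≡m%n; [m+n]%n≡m%n; m<n⇒m%n≡m)
open import Data.Nat.Divisibility using (_∣_; divides)
open import Data.Nat.Properties
open import Data.Nat.Tactic.RingSolver using (solve-∀)
open import Data.Product using (Σ; ∃; _×_; _,_; proj₁; proj₂)
open import Data.Sum using (_⊎_; inj₁; inj₂; [_,_]′)
open import Data.Vec using ([]; _∷_; here; there)
open import Function using (_∘_)
open import Function.Bundles using (_⇔_; mk⇔; Equivalence)
open import Relation.Binary using (Tri; tri<; tri≈; tri>)
open import Relation.Binary.PropositionalEquality
open import Relation.Nullary using (¬_; yes; no)

open import Defs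

%≡⇒∣∸ : ∀ {m r s} → m % suc s ≡ r → suc s ∣ m ∸ r
%≡⇒∣∸ {m} {r} {s} m%≡r = divides (m / suc s) (begin
  m ∸ r                              ≡⟨ cong (_∸ r) (m≡m%n+[m/n]*n m (suc s)) ⟩
  m % suc s + m / suc s * suc s ∸ r  ≡⟨ cong (λ z → z + m / suc s * suc s ∸ r) m%≡r ⟩
  r + m / suc s * suc s ∸ r          ≡⟨ m+n∸m≡n r _ ⟩
  m / suc s * suc s                  ∎)
  where open ≡-Reasoning

2*m+1≡1+m+m : ∀ m → 2 * m + 1 ≡ suc (m + m)
2*m+1≡1+m+m = solve-∀

[m%n+o]%n≡[m+o]%n : ∀ m o n .{{_ : NonZero n}} → (m % n + o) % n ≡ (m + o) % n
[m%n+o]%n≡[m+o]%n m o n = begin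
  (m % n + o) % n          ≡⟨ %-distribˡ-+ (m % n) o n ⟩
  (m % n % n + o % n) % n  ≡⟨ cong (λ z → (z + o % n) % n) (m%n%n≡m%n m n) ⟩
  (m % n + o % n) % n      ≡⟨ %-distribˡ-+ m o n ⟨
  (m + o) % n              ∎
  where open ≡-Reasoning

-- Counting

bit : Bool → ℕ
bit false = 0
bit true  = 1

count : (ℕ → Bool) → ℕ → ℕ
count P zero    = 0
count P (suc m) = count P m + bit (P m)

count-split : ∀ P a m → count P (a + m) ≡ count P a + count (P ∘ (a +_)) m
count-split P a zero    = trans (cong (count P) (+-identityʳ a)) (sym (+-identityʳ _))
count-split P a (suc m) = begin
  count P (a + suc m)                                 ≡⟨ cong (count P) (+-suc a m) ⟩
  count P (a + m) + bit (P (a + m))                   ≡⟨ cong (_+ bit (P (a + m))) (count-split P a m) ⟩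
  count P a + count (P ∘ (a +_)) m + bit (P (a + m))  ≡⟨ +-assoc (count P a) _ _ ⟩
  count P a + count (P ∘ (a +_)) (suc m)              ∎
  where open ≡-Reasoning

count-suc : ∀ P m → count P (suc m) ≡ bit (P 0) + count (P ∘ suc) m
count-suc P = count-split P 1

count-cong : ∀ {P Q} m → (∀ {k} → k < m → P k ≡ Q k) → count P m ≡ count Q m
count-cong zero    _  = refl
count-cong (suc m) eq = cong₂ _+_ (count-cong m (λ k<m → eq (m<n⇒m<1+n k<m))) (cong bit (eq ≤-refl))

count-mono : ∀ P {m m'} → m ≤ m' → count P m ≤ count P m'
count-mono P {m' = zero}  z≤n = ≤-refl
count-mono P {m' = suc m'} m≤ with m≤n⇒m<n∨m≡n m≤
... | inj₂ refl = ≤-refl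
... | inj₁ m<  = ≤-trans (count-mono P (s≤s⁻¹ m<)) (m≤m+n _ _)

count-vanish : ∀ P {a b} → a ≤ b → (∀ {k} → a ≤ k → k < b → P k ≡ false) → count P b ≡ count P a
count-vanish P {b = zero}  z≤n _ = refl
count-vanish P {a} {suc b} a≤ gap with m≤n⇒m<n∨m≡n a≤
... | inj₂ refl = refl
... | inj₁ a<   = begin
  count P b + bit (P b)  ≡⟨ cong (λ x → count P b + bit x) (gap (s≤s⁻¹ a<) ≤-refl) ⟩
  count P b + 0          ≡⟨ +-identityʳ _ ⟩
  count P b              ≡⟨ count-vanish P (s≤s⁻¹ a<) (λ a≤k k<b → gap a≤k (m<n⇒m<1+n k<b)) ⟩
  count P a              ∎
  where open ≡-Reasoning

count-first : ∀ P m → count P m ≡ 0 ⊎ ∃ λ x → x < m × P x ≡ true × count P x ≡ 0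
count-first P zero = inj₁ refl
count-first P (suc m) with count-first P m
... | inj₂ (x , x<m , Px , none) = inj₂ (x , m<n⇒m<1+n x<m , Px , none)
... | inj₁ none with P m in Pm
...   | true  = inj₂ (m , ≤-refl , Pm , none)
...   | false = inj₁ (trans (+-identityʳ _) none)

count-witness : ∀ P {x m} → x < m → P x ≡ true → suc (count P x) ≤ count P m
count-witness P {x} x<m Px = ≤-trans (≤-reflexive counted) (count-mono P x<m)
  where
  counted : suc (count P x) ≡ count P (suc x)
  counted = trans (+-comm 1 (count P x)) (cong (λ b → count P x + bit b) (sym Px))

count-two : ∀ P {i j m} → i < j → j < m → P i ≡ true → P j ≡ true → 2 ≤ count P m
count-two P i<j j<m Pi Pj =
  ≤-trans (s≤s (≤-trans (s≤s z≤n) (count-witness P i<j Pi))) (count-witness P j<m Pj)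

count-progression : ∀ P a s c → (∀ {i} → i < c → P (a + i * suc s) ≡ true) →
  count P a + c ≤ count P (a + c * suc s)
count-progression P a s zero _ =
  ≤-reflexive (trans (+-identityʳ _) (cong (count P) (sym (+-identityʳ a))))
count-progression P a s (suc c) hits = begin
  count P a + suc c                ≡⟨ +-suc (count P a) c ⟩
  suc (count P a + c)              ≤⟨ s≤s (count-progression P a s c (λ i<c → hits (m<n⇒m<1+n i<c))) ⟩
  suc (count P (a + c * suc s))    ≤⟨ count-witness P (+-monoʳ-< a (m<n+m (c * suc s) z<s)) (hits ≤-refl) ⟩
  count P (a + suc c * suc s)      ∎
  where open ≤-Reasoning

-- Packing

Spaced : ℕ → (ℕ → Bool) → ℕ → Set
Spaced d P m = ∀ {i j} → i < j → j < m → P i ≡ true → P j ≡ true → i + d < j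

Spaced-≤ : ∀ {d P m m'} → m' ≤ m → Spaced d P m → Spaced d P m'
Spaced-≤ m'≤m spaced i<j j<m' = spaced i<j (<-≤-trans j<m' m'≤m)

-- Each marked k occupies the d + 1 slots k, …, k + d, which are disjoint and lie below B.
count-spaced : ∀ d P m B → Spaced d P m → (∀ {k} → k < m → P k ≡ true → k + d < B) →
  count P m * suc d ≤ B
count-spaced d P zero    B _      _       = z≤n
count-spaced d P (suc p) B spaced bounded with P p in Pp
... | false = begin
  (count P p + 0) * suc d  ≡⟨ cong (_* suc d) (+-identityʳ (count P p)) ⟩
  count P p * suc d        ≤⟨ count-spaced d P p B (Spaced-≤ (n≤1+n p) spaced)
                                (λ k<p → bounded (m<n⇒m<1+n k<p)) ⟩
  B                        ∎
  where open ≤-Reasoning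
... | true = begin
  (count P p + 1) * suc d      ≡⟨ +-*-suc (count P p) d ⟩
  count P p * suc d + suc d    ≤⟨ +-monoˡ-≤ (suc d) (count-spaced d P p p (Spaced-≤ (n≤1+n p) spaced)
                                    (λ k<p Pk → spaced k<p ≤-refl Pk Pp)) ⟩
  p + suc d                    ≡⟨ +-suc p d ⟩
  suc (p + d)                  ≤⟨ bounded ≤-refl Pp ⟩
  B                            ∎
  where
  open ≤-Reasoning
  +-*-suc : ∀ c d → (c + 1) * suc d ≡ c * suc d + suc d
  +-*-suc = solve-∀

CyclicallySpaced : ℕ → ℕ → (ℕ → Bool) → Set
CyclicallySpaced n d P =
  ∀ {i j} → i < j → j < n → P i ≡ true → P j ≡ true → i + d < j × j + d < n + i

-- Cut the cycle open at the first marked point x; the wrap-around condition against x keeps every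
-- other marked point k within k + d < n.
count-cyclicallySpaced : ∀ {n d} P → d < n → CyclicallySpaced n d P → count P n * suc d ≤ n
count-cyclicallySpaced {n} {d} P d<n cyclic with count-first P n
... | inj₁ none rewrite none = z≤n
... | inj₂ (x , x<n , Px , none) with m≤n⇒∃[o]m+o≡n (<⇒≤ x<n)
...   | L , refl = begin
  count P (x + L) * suc d                 ≡⟨ cong (_* suc d) (count-split P x L) ⟩
  (count P x + count Q L) * suc d         ≡⟨ cong (λ c → (c + count Q L) * suc d) none ⟩
  count Q L * suc d                       ≤⟨ count-spaced d Q L (x + L) spaced bounded ⟩
  x + L                                   ∎
  where
  open ≤-Reasoning
  Q = P ∘ (x +_)
  spaced : Spaced d Q L
  spaced {i} {j} i<j j<L Qi Qj = +-cancelˡ-< x (i + d) j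
    (subst (_< x + j) (+-assoc x i d) (proj₁ (cyclic (+-monoʳ-< x i<j) (+-monoʳ-< x j<L) Qi Qj)))
  bounded : ∀ {k} → k < L → Q k ≡ true → k + d < x + L
  bounded {zero}  _   _  = d<n
  bounded {suc k} k<L Qk = +-cancelʳ-< x (suc k + d) (x + L)
    (subst (_< x + L + x) (rearrange x (suc k) d)
      (proj₂ (cyclic (m<m+n x z<s) (+-monoʳ-< x k<L) Px Qk)))
    where
    rearrange : ∀ x k d → x + k + d ≡ k + d + x
    rearrange = solve-∀

≡ᵇ-sound : ∀ {m n} → (m ≡ᵇ n) ≡ true → m ≡ n
≡ᵇ-sound {m} {n} eq = ≡ᵇ⇒≡ m n (Equivalence.from Bool.T-≡ eq)

≡ᵇ-refl : ∀ m → (m ≡ᵇ m) ≡ true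
≡ᵇ-refl m = Equivalence.to Bool.T-≡ (≡⇒≡ᵇ m m refl)

progression : ℕ → ℕ → ℕ → ℕ → Bool
progression a s zero    o = false
progression a s (suc c) o = (o ≡ᵇ a + c * s) ∨ progression a s c o

progression-sound : ∀ {a s c o} → progression a s c o ≡ true → ∃ λ i → i < c × o ≡ a + i * s
progression-sound {a} {s} {suc c} {o} hit with o ≡ᵇ a + c * s in o≡
... | true  = c , ≤-refl , ≡ᵇ-sound o≡
... | false with progression-sound {a} {s} {c} hit
...   | i , i<c , o≡' = i , m<n⇒m<1+n i<c , o≡'

progression-complete : ∀ {a s c i} → i < c → progression a s c (a + i * s) ≡ true
progression-complete {a} {s} {suc c} {i} i<sc with m≤n⇒m<n∨m≡n (s≤s⁻¹ i<sc)
... | inj₂ refl rewrite ≡ᵇ-refl (a + i * s) = refl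
... | inj₁ i<c  rewrite progression-complete {a} {s} {c} i<c = Bool.∨-zeroʳ _

progression-gap : ∀ a s {i c} → i < c → a + i * suc s + s < a + c * suc s
progression-gap a s {i} {c} i<c = begin-strict
  a + i * suc s + s        <⟨ +-monoʳ-< (a + i * suc s) (n<1+n s) ⟩
  a + i * suc s + suc s    ≡⟨ +-assoc a (i * suc s) (suc s) ⟩
  a + (i * suc s + suc s)  ≡⟨ cong (a +_) (+-comm (i * suc s) (suc s)) ⟩
  a + suc i * suc s        ≤⟨ +-monoʳ-≤ a (*-monoˡ-≤ (suc s) i<c) ⟩
  a + c * suc s            ∎
  where open ≤-Reasoning

progression-spaced : ∀ {a s c i j} → progression a (suc s) c i ≡ true →
  progression a (suc s) c j ≡ true → i < j → i + s < j
progression-spaced {a} {s} {c} {i} {j} hi hj i<j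
  with progression-sound {a} {suc s} {c} {i} hi | progression-sound {a} {suc s} {c} {j} hj
... | i₁ , _ , refl | i₂ , _ , refl =
  progression-gap a s (*-cancelʳ-< (suc s) i₁ i₂ (+-cancelˡ-< a (i₁ * suc s) (i₂ * suc s) i<j))

-- Rotation of ℕ modulo n

offset : ∀ {n} .{{_ : NonZero n}} → Fin n → ℕ → ℕ
offset {n} u k = (k + (n ∸ toℕ u)) % n

module _ {n : ℕ} .{{_ : NonZero n}} (u : Fin n) where

  private
    s = n ∸ toℕ u
    u+s≡n : toℕ u + s ≡ n
    u+s≡n = m+[n∸m]≡n (<⇒≤ (toℕ<n u))

  offset-step : ∀ k t → offset u ((k + t) % n) ≡ (offset u k + t) % n
  offset-step k t = begin
    ((k + t) % n + s) % n  ≡⟨ [m%n+o]%n≡[m+o]%n (k + t) s n ⟩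
    (k + t + s) % n        ≡⟨ cong (_% n) (swap k t s) ⟩
    (k + s + t) % n        ≡⟨ [m%n+o]%n≡[m+o]%n (k + s) t n ⟨
    ((k + s) % n + t) % n  ∎
    where
    open ≡-Reasoning
    swap : ∀ k t s → k + t + s ≡ k + s + t
    swap = solve-∀

  offset-inverse : ∀ (x : Fin n) → (toℕ u + offset u (toℕ x)) % n ≡ toℕ x
  offset-inverse x = begin
    (toℕ u + (k + s) % n) % n  ≡⟨ cong (_% n) (+-comm (toℕ u) _) ⟩
    ((k + s) % n + toℕ u) % n  ≡⟨ [m%n+o]%n≡[m+o]%n (k + s) (toℕ u) n ⟩
    (k + s + toℕ u) % n        ≡⟨ cong (_% n) (swap k s (toℕ u)) ⟩
    (k + (toℕ u + s)) % n      ≡⟨ cong (λ z → (k + z) % n) u+s≡n ⟩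
    (k + n) % n                ≡⟨ [m+n]%n≡m%n k n ⟩
    k % n                      ≡⟨ m<n⇒m%n≡m (toℕ<n x) ⟩
    k                          ∎
    where
    open ≡-Reasoning
    k = toℕ x
    swap : ∀ k s a → k + s + a ≡ k + (a + s)
    swap = solve-∀

  count-offset : ∀ P → count (P ∘ offset u) n ≡ count P n
  count-offset P = begin
    count (P ∘ offset u) n                                        ≡⟨ cong (count _) u+s≡n ⟨
    count (P ∘ offset u) (toℕ u + s)                              ≡⟨ count-split _ (toℕ u) s ⟩
    count (P ∘ offset u) (toℕ u) + count (P ∘ offset u ∘ (toℕ u +_)) s
                                                                   ≡⟨ cong₂ _+_ (count-cong (toℕ u) before)
                                                                                 (count-cong s after) ⟩
    count (P ∘ (s +_)) (toℕ u) + count P s                        ≡⟨ +-comm _ (count P s) ⟩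
    count P s + count (P ∘ (s +_)) (toℕ u)                        ≡⟨ count-split P s (toℕ u) ⟨
    count P (s + toℕ u)                                           ≡⟨ cong (count P) (+-comm s _) ⟩
    count P (toℕ u + s)                                           ≡⟨ cong (count P) u+s≡n ⟩
    count P n                                                     ∎
    where
    open ≡-Reasoning
    before : ∀ {k} → k < toℕ u → P (offset u k) ≡ P (s + k)
    before {k} k<u = cong P (trans (m<n⇒m%n≡m (subst (k + s <_) u+s≡n (+-monoˡ-< s k<u))) (+-comm k s))
    after : ∀ {k} → k < s → P (offset u (toℕ u + k)) ≡ P k
    after {k} k<s = cong P (begin
      (toℕ u + k + s) % n    ≡⟨ cong (_% n) (trans (swap (toℕ u) k s) (cong (k +_) u+s≡n)) ⟩
      (k + n) % n            ≡⟨ [m+n]%n≡m%n k n ⟩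
      k % n                  ≡⟨ m<n⇒m%n≡m (<-≤-trans k<s (m∸n≤m n (toℕ u))) ⟩
      k                      ∎)
      where
      swap : ∀ a k s → a + k + s ≡ k + (a + s)
      swap = solve-∀

-- Independent sets and vertex covers

Independent : ∀ {n} → Graph n → (ℕ → Bool) → Set
Independent G P = ∀ x y → Adj G x y → P (toℕ x) ≡ true → P (toℕ y) ≡ true → ⊥

independent-fromℕ< : ∀ {n} {G : Graph n} {P i j} (i<n : i < n) (j<n : j < n) → Independent G P →
  P i ≡ true → P j ≡ true → ¬ Adj G (fromℕ< i<n) (fromℕ< j<n)
independent-fromℕ< {P = P} i<n j<n indep Pi Pj adj =
  indep _ _ adj (subst (λ k → P k ≡ true) (sym (toℕ-fromℕ< i<n)) Pi)
                (subst (λ k → P k ≡ true) (sym (toℕ-fromℕ< j<n)) Pj)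

independent-restore : ∀ {n} {G : Graph n} {a b} (ab : Adj G a b) {P} →
  Independent (deleteEdge G (a , b , ab)) P → ¬ (P (toℕ a) ≡ true × P (toℕ b) ≡ true) → Independent G P
independent-restore {a = a} {b} ab indep ¬both x y xy Px Py = indep x y (xy , distinct) Px Py
  where
  distinct : ¬ SamePair x y a b
  distinct (inj₁ (refl , refl)) = ¬both (Px , Py)
  distinct (inj₂ (refl , refl)) = ¬both (Py , Px)

SamePair-swap : ∀ {n} {x y a b : Fin n} → SamePair x y a b → SamePair x y b a
SamePair-swap (inj₁ p) = inj₂ p
SamePair-swap (inj₂ p) = inj₁ p

fromℕ<-SamePair : ∀ {n i j a b} .{i<n : i < n} .{j<n : j < n} .{a<n : a < n} .{b<n : b < n} →
  SamePair (fromℕ< i<n) (fromℕ< j<n) (fromℕ< a<n) (fromℕ< b<n) → (i ≡ a × j ≡ b) ⊎ (i ≡ b × j ≡ a)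
fromℕ<-SamePair (inj₁ (i≡a , j≡b)) = inj₁ (fromℕ<-injective _ _ _ _ i≡a , fromℕ<-injective _ _ _ _ j≡b)
fromℕ<-SamePair (inj₂ (i≡b , j≡a)) = inj₂ (fromℕ<-injective _ _ _ _ i≡b , fromℕ<-injective _ _ _ _ j≡a)

endpoints : ∀ {n} → Fin n → Fin n → ℕ → Bool
endpoints a b k = (k ≡ᵇ toℕ a) ∨ (k ≡ᵇ toℕ b)

endpoints-sound : ∀ {n} {a b x : Fin n} → endpoints a b (toℕ x) ≡ true → x ≡ a ⊎ x ≡ b
endpoints-sound {a = a} {b} {x} hit with toℕ x ≡ᵇ toℕ a in x≡a
... | true  = inj₁ (toℕ-injective (≡ᵇ-sound x≡a))
... | false = inj₂ (toℕ-injective (≡ᵇ-sound hit))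

endpoints-independent : ∀ {n} {G : Graph n} → (∀ {x} → ¬ Adj G x x) → ∀ {a b} (ab : Adj G a b) →
  Independent (deleteEdge G (a , b , ab)) (endpoints a b)
endpoints-independent loopless ab x y (xy , distinct) Px Py
  with endpoints-sound {x = x} Px | endpoints-sound {x = y} Py
... | inj₁ refl | inj₁ refl = loopless xy
... | inj₁ refl | inj₂ refl = distinct (inj₁ (refl , refl))
... | inj₂ refl | inj₁ refl = distinct (inj₂ (refl , refl))
... | inj₂ refl | inj₂ refl = loopless xy

count-endpoints : ∀ {n} {a b : Fin n} → a ≢ b → 2 ≤ count (endpoints a b) n
count-endpoints {n} {a} {b} a≢b = by-order (<-cmp (toℕ a) (toℕ b))
  where
  hit-a : endpoints a b (toℕ a) ≡ true
  hit-a rewrite ≡ᵇ-refl (toℕ a) = refl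
  hit-b : endpoints a b (toℕ b) ≡ true
  hit-b rewrite ≡ᵇ-refl (toℕ b) = Bool.∨-zeroʳ _
  by-order : Tri (toℕ a < toℕ b) (toℕ a ≡ toℕ b) (toℕ b < toℕ a) → 2 ≤ count (endpoints a b) n
  by-order (tri< a<b _ _) = count-two _ a<b (toℕ<n b) hit-a hit-b
  by-order (tri≈ _ a≡b _) = ⊥-elim (a≢b (toℕ-injective a≡b))
  by-order (tri> _ _ b<a) = count-two _ b<a (toℕ<n a) hit-b hit-a

outside : ∀ {n} → Subset n → ℕ → Bool
outside []      _       = true
outside (b ∷ S) zero    = not b
outside (b ∷ S) (suc k) = outside S k

complementOf : ∀ n → (ℕ → Bool) → Subset n
complementOf zero    P = []
complementOf (suc n) P = not (P 0) ∷ complementOf n (P ∘ suc)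

∈⇒outside≡false : ∀ {n} {S : Subset n} {x} → x ∈ S → outside S (toℕ x) ≡ false
∈⇒outside≡false here        = refl
∈⇒outside≡false (there x∈S) = ∈⇒outside≡false x∈S

∈-complementOf : ∀ {n} P {x : Fin n} → P (toℕ x) ≡ false → x ∈ complementOf n P
∈-complementOf P {fzero}  P0 rewrite P0 = here
∈-complementOf P {fsuc x} Px = there (∈-complementOf (P ∘ suc) Px)

∣∷∣+count : ∀ {n} b (S : Subset n) c → ∣ S ∣ + c ≡ n → ∣ b ∷ S ∣ + (bit (not b) + c) ≡ suc n
∣∷∣+count true  S c eq = cong suc eq
∣∷∣+count false S c eq = trans (+-suc ∣ S ∣ c) (cong suc eq)

∣S∣+count-outside : ∀ {n} (S : Subset n) → ∣ S ∣ + count (outside S) n ≡ n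
∣S∣+count-outside []                = refl
∣S∣+count-outside {suc n} (b ∷ S) =
  trans (cong (∣ b ∷ S ∣ +_) (count-suc (outside (b ∷ S)) n)) (∣∷∣+count b S _ (∣S∣+count-outside S))

∣complementOf∣+count : ∀ n P → ∣ complementOf n P ∣ + count P n ≡ n
∣complementOf∣+count zero    P = refl
∣complementOf∣+count (suc n) P =
  trans (cong (∣ not (P 0) ∷ T ∣ +_) (count-suc P n))
    (subst (λ b → ∣ not (P 0) ∷ T ∣ + (bit b + count (P ∘ suc) n) ≡ suc n) (Bool.not-involutive (P 0))
      (∣∷∣+count (not (P 0)) T _ (∣complementOf∣+count n (P ∘ suc))))
  where
  T = complementOf n (P ∘ suc)

cover⇒independent : ∀ {n} {G : Graph n} {S} → IsVertexCover G S → Independent G (outside S)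
cover⇒independent cover x y xy out-x out-y with cover x y xy
... | inj₁ x∈S with () ← trans (sym out-x) (∈⇒outside≡false x∈S)
... | inj₂ y∈S with () ← trans (sym out-y) (∈⇒outside≡false y∈S)

independent⇒cover : ∀ {n} {G : Graph n} {P} → Independent G P → IsVertexCover G (complementOf n P)
independent⇒cover {P = P} indep x y xy with P (toℕ x) in Px | P (toℕ y) in Py
... | false | _     = inj₁ (∈-complementOf P Px)
... | true  | false = inj₂ (∈-complementOf P Py)
... | true  | true  = ⊥-elim (indep x y xy Px Py)

module _ {n} {P : ℕ → Bool} (S : Subset n) where

  complementOf-≤ : count (outside S) n ≤ count P n → ∣ complementOf n P ∣ ≤ ∣ S ∣
  complementOf-≤ fewer = +-cancelʳ-≤ (count P n) _ _ (begin
    ∣ complementOf n P ∣ + count P n  ≡⟨ ∣complementOf∣+count n P ⟩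
    n                                 ≡⟨ ∣S∣+count-outside S ⟨
    ∣ S ∣ + count (outside S) n       ≤⟨ +-monoʳ-≤ ∣ S ∣ fewer ⟩
    ∣ S ∣ + count P n                 ∎)
    where open ≤-Reasoning

  complementOf-< : count (outside S) n < count P n → ∣ complementOf n P ∣ < ∣ S ∣
  complementOf-< fewer = +-cancelʳ-< (count P n) _ _ (begin-strict
    ∣ complementOf n P ∣ + count P n  ≡⟨ ∣complementOf∣+count n P ⟩
    n                                 ≡⟨ ∣S∣+count-outside S ⟨
    ∣ S ∣ + count (outside S) n       <⟨ +-monoʳ-< ∣ S ∣ fewer ⟩
    ∣ S ∣ + count P n                 ∎)
    where open ≤-Reasoning

EdgeCritical : ∀ {n} → Graph n → Set
EdgeCritical G =
  ∀ (e : Edge G) (k k' : ℕ) → IsMinVCSize G k → IsMinVCSize (deleteEdge G e) k' → k' < k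

edgeCritical : ∀ {n} {G : Graph n} α → (∀ P → Independent G P → count P n ≤ α) →
  (∀ e → Σ (ℕ → Bool) λ P → Independent (deleteEdge G e) P × α < count P n) → EdgeCritical G
edgeCritical α bound larger e k k' ((S , cover , refl) , _) (_ , minimal') with larger e
... | P , indep , α<P = ≤-<-trans (minimal' _ (independent⇒cover indep))
                          (complementOf-< S (≤-<-trans (bound _ (cover⇒independent cover)) α<P))

minVC-shared : ∀ {n} {G G' : Graph n} {P} → (∀ {x y} → Adj G' x y → Adj G x y) →
  Independent G P → (∀ Q → Independent G' Q → count Q n ≤ count P n) →
  IsMinVCSize G ∣ complementOf n P ∣ × IsMinVCSize G' ∣ complementOf n P ∣
minVC-shared {n} {G} {G'} {P} sub indep bound =
  ((T , cover , refl) , λ S cov → minimal' S (λ x y xy → cov x y (sub xy))) ,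
  ((T , (λ x y xy → cover x y (sub xy)) , refl) , minimal')
  where
  T = complementOf n P
  cover = independent⇒cover indep
  minimal' : ∀ S → IsVertexCover G' S → ∣ T ∣ ≤ ∣ S ∣
  minimal' S cov = complementOf-≤ S (bound _ (cover⇒independent cov))

¬edgeCritical : ∀ {n} {G : Graph n} (e : Edge G) {P} → Independent G P →
  (∀ Q → Independent (deleteEdge G e) Q → count Q n ≤ count P n) → ¬ EdgeCritical G
¬edgeCritical e indep bound critical =
  <-irrefl refl (critical e _ _ (proj₁ shared) (proj₂ shared))
  where shared = minVC-shared proj₁ indep bound

reachable-++ : ∀ {n} {G : Graph n} {x y z} → Reachable G x y → Reachable G y z → Reachable G x z
reachable-++ here       q = q
reachable-++ (step a p) q = step a (reachable-++ p q)

reachable-reverse : ∀ {n} {G : Graph n} → (∀ {x y} → Adj G x y → Adj G y x) →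
  ∀ {x y} → Reachable G x y → Reachable G y x
reachable-reverse sym here       = here
reachable-reverse sym (step a p) = reachable-++ (reachable-reverse sym p) (step (sym a) here)

-- The circulant graph C n d

module Circulant (n d : ℕ) .{{_ : NonZero n}} where

  close-adjacent : ∀ {i j} (i<n : i < n) (j<n : j < n) → i < j → j ≤ i + d →
    CircAdj n d (fromℕ< i<n) (fromℕ< j<n)
  close-adjacent {i} {j} i<n j<n i<j j≤i+d =
    distinct , j ∸ i , m<n⇒0<n∸m i<j , m≤n+o⇒m∸n≤o j i j≤i+d , inj₁ forward
    where
    distinct : fromℕ< i<n ≢ fromℕ< j<n
    distinct eq = <⇒≢ i<j (fromℕ<-injective i j i<n j<n eq)
    forward : toℕ (fromℕ< j<n) ≡ (toℕ (fromℕ< i<n) + (j ∸ i)) % n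
    forward rewrite toℕ-fromℕ< j<n | toℕ-fromℕ< i<n | m+[n∸m]≡n (<⇒≤ i<j) = sym (m<n⇒m%n≡m j<n)

  wrap-adjacent : ∀ {i j} (i<n : i < n) (j<n : j < n) → i < j → n + i ≤ j + d →
    CircAdj n d (fromℕ< j<n) (fromℕ< i<n)
  wrap-adjacent {i} {j} i<n j<n i<j n+i≤j+d =
    distinct , (n + i) ∸ j , m<n⇒0<n∸m j<n+i , m≤n+o⇒m∸n≤o (n + i) j n+i≤j+d , inj₁ forward
    where
    j<n+i : j < n + i
    j<n+i = <-≤-trans j<n (m≤m+n n i)
    distinct : fromℕ< j<n ≢ fromℕ< i<n
    distinct eq = >⇒≢ i<j (fromℕ<-injective j i j<n i<n eq)
    forward : toℕ (fromℕ< i<n) ≡ (toℕ (fromℕ< j<n) + ((n + i) ∸ j)) % n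
    forward rewrite toℕ-fromℕ< j<n | toℕ-fromℕ< i<n | m+[n∸m]≡n (<⇒≤ j<n+i) =
      sym (trans (cong (_% n) (+-comm n i)) (trans ([m+n]%n≡m%n i n) (m<n⇒m%n≡m i<n)))

  circAdj-sym : ∀ {x y} → CircAdj n d x y → CircAdj n d y x
  circAdj-sym (x≢y , t , 1≤t , t≤d , inj₁ fwd) = x≢y ∘ sym , t , 1≤t , t≤d , inj₂ fwd
  circAdj-sym (x≢y , t , 1≤t , t≤d , inj₂ bwd) = x≢y ∘ sym , t , 1≤t , t≤d , inj₁ bwd

  connected : 1 ≤ d → Connected (C n d)
  connected 1≤d x y = subst₂ (Reachable (C n d)) (fromℕ<-toℕ x (toℕ<n x)) (fromℕ<-toℕ y (toℕ<n y))
    (reachable-++ (descend (toℕ x) (toℕ<n x)) (reachable-reverse circAdj-sym (descend (toℕ y) (toℕ<n y))))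
    where
    descend : ∀ i (i<n : i < n) → Reachable (C n d) (fromℕ< i<n) (fromℕ< (>-nonZero⁻¹ n))
    descend zero    _     = here
    descend (suc i) 1+i<n =
      step (circAdj-sym (close-adjacent i<n 1+i<n (n<1+n i) 1+i≤i+d)) (descend i i<n)
      where
      i<n : i < n
      i<n = <-trans (n<1+n i) 1+i<n
      1+i≤i+d : suc i ≤ i + d
      1+i≤i+d = subst (_≤ i + d) (+-comm i 1) (+-monoʳ-≤ i 1≤d)

  cyclicallySpaced : ∀ {P} → Independent (C n d) P → CyclicallySpaced n d P
  cyclicallySpaced indep {i} {j} i<j j<n Pi Pj =
    ≰⇒> (λ j≤i+d → independent-fromℕ< i<n j<n indep Pi Pj (close-adjacent i<n j<n i<j j≤i+d)) ,
    ≰⇒> (λ n+i≤j+d → independent-fromℕ< j<n i<n indep Pj Pi (wrap-adjacent i<n j<n i<j n+i≤j+d))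
    where
    i<n : i < n
    i<n = <-trans i<j j<n

  independence-≤-small : n ≤ 2 * d + 1 → ∀ {P} → Independent (C n d) P → count P n ≤ 1
  independence-≤-small small {P} indep = s≤s⁻¹ (*-cancelʳ-< (suc d) (count P n) 2 below)
    where
    double : ∀ d → 2 * suc d ≡ suc (suc (d + d))
    double = solve-∀
    spaced : Spaced d P n
    spaced i<j j<n Pi Pj = proj₁ (cyclicallySpaced indep i<j j<n Pi Pj)
    below : count P n * suc d < 2 * suc d
    below with d <? n
    ... | yes d<n = ≤-<-trans (count-cyclicallySpaced P d<n (cyclicallySpaced indep))
                      (subst (n <_) (sym (double d)) (s≤s (subst (n ≤_) (2*m+1≡1+m+m d) small)))
    ... | no  d≮n = ≤-<-trans (count-spaced d P n (n + d) spaced (λ k<n _ → +-monoˡ-< d k<n))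
                      (subst (n + d <_) (sym (double d)) (s≤s (m≤n⇒m≤1+n (+-monoˡ-≤ d (≮⇒≥ d≮n)))))

  independence-≤-periodic : ∀ {c} → d < n → n ≡ d + c * suc d → ∀ {P} → Independent (C n d) P →
    count P n ≤ c
  independence-≤-periodic {c} d<n n≡ {P} indep = s≤s⁻¹ (*-cancelʳ-< (suc d) (count P n) (suc c)
    (≤-<-trans (count-cyclicallySpaced P d<n (cyclicallySpaced indep))
      (subst (_< suc c * suc d) (sym n≡) (+-monoˡ-< (c * suc d) (n<1+n d)))))

  Near : ℕ → ℕ → Set
  Near i j = i < j × j ≤ i + d

  offset-step-Near : ∀ (u : Fin n) {k l t} → l ≡ (k + t) % n → 1 ≤ t → t ≤ d → offset u k + d < n →
    Near (offset u k) (offset u l)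
  offset-step-Near u {k} {t = t} refl 1≤t t≤d fits
    rewrite offset-step u k t | m<n⇒m%n≡m (≤-<-trans (+-monoʳ-≤ (offset u k) t≤d) fits) =
    m<m+n (offset u k) 1≤t , +-monoʳ-≤ (offset u k) t≤d

  -- The hypothesis on Q excludes wrap-around, so a circulant step becomes a step of length ≤ d.
  circAdj-offset-Near : ∀ (u : Fin n) {Q : ℕ → Bool} → (∀ {o} → Q o ≡ true → o + d < n) →
    ∀ {x y} → CircAdj n d x y → Q (offset u (toℕ x)) ≡ true → Q (offset u (toℕ y)) ≡ true →
    Near (offset u (toℕ x)) (offset u (toℕ y)) ⊎ Near (offset u (toℕ y)) (offset u (toℕ x))
  circAdj-offset-Near u fits (_ , t , 1≤t , t≤d , inj₁ fwd) Qx _ =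
    inj₁ (offset-step-Near u fwd 1≤t t≤d (fits Qx))
  circAdj-offset-Near u fits (_ , t , 1≤t , t≤d , inj₂ bwd) _ Qy =
    inj₂ (offset-step-Near u bwd 1≤t t≤d (fits Qy))

  independent-offset : ∀ (u : Fin n) {Q : ℕ → Bool} → (∀ {o} → Q o ≡ true → o + d < n) →
    (∀ {i j} → Near i j → Q i ≡ true → Q j ≡ true → ⊥) → Independent (C n d) (Q ∘ offset u)
  independent-offset u fits apart x y xy Qx Qy =
    [ (λ near → apart near Qx Qy) , (λ near → apart near Qy Qx) ]′ (circAdj-offset-Near u fits xy Qx Qy)

  edge-progression : ℕ → ℕ → ℕ → Bool
  edge-progression t c o = (o ≡ᵇ 0) ∨ progression t (suc d) c o

  edge-progression-Near : ∀ {t c i j} → Near i j → edge-progression t c i ≡ true →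
    edge-progression t c j ≡ true → i ≡ 0 × j ≡ t
  edge-progression-Near {t} {c} {i} {j} (i<j , j≤i+d) hi hj with i ≡ᵇ 0 in i≡0 | j ≡ᵇ 0 in j≡0
  ... | _     | true  = ⊥-elim (n≮0 (subst (i <_) (≡ᵇ-sound j≡0) i<j))
  ... | false | false = ⊥-elim (<⇒≱ (progression-spaced {t} {d} {c} hi hj i<j) j≤i+d)
  ... | true  | false with progression-sound {t} {suc d} {c} {j} hj
  ...   | zero  , _ , j≡ = ≡ᵇ-sound i≡0 , trans j≡ (+-identityʳ t)
  ...   | suc m , _ , refl =
    ⊥-elim (<⇒≱ (≤-trans (m≤m+n (suc d) (m * suc d)) (m≤n+m _ t))
                 (subst (λ z → t + suc m * suc d ≤ z + d) (≡ᵇ-sound i≡0) j≤i+d))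

  edge-progression-fits : ∀ {t c} → t + c * suc d ≤ n → d < n →
    ∀ {o} → edge-progression t c o ≡ true → o + d < n
  edge-progression-fits {t} {c} room d<n {o} hit with o ≡ᵇ 0 in o≡0
  ... | true  = subst (λ z → z + d < n) (sym (≡ᵇ-sound o≡0)) d<n
  ... | false with progression-sound {t} {suc d} {c} {o} hit
  ...   | i , i<c , refl = <-≤-trans (progression-gap t d i<c) room

  count-edge-progression : ∀ {t c} → 1 ≤ t → t + c * suc d ≤ n → suc c ≤ count (edge-progression t c) n
  count-edge-progression {t} {c} 1≤t room = begin
    suc c                     ≤⟨ +-monoˡ-≤ c (count-witness (edge-progression t c) 1≤t refl) ⟩
    count (edge-progression t c) t + c  ≤⟨ count-progression (edge-progression t c) t d c hits ⟩
    count (edge-progression t c) (t + c * suc d)  ≤⟨ count-mono (edge-progression t c) room ⟩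
    count (edge-progression t c) n    ∎
    where
    open ≤-Reasoning
    hits : ∀ {i} → i < c → edge-progression t c (t + i * suc d) ≡ true
    hits i<c = trans (cong (_ ∨_) (progression-complete i<c)) (Bool.∨-zeroʳ _)

  edge-progression-SamePair : ∀ (u w : Fin n) {t c} → toℕ w ≡ (toℕ u + t) % n → t + c * suc d ≤ n → d < n →
    ∀ {x y} → CircAdj n d x y → edge-progression t c (offset u (toℕ x)) ≡ true →
    edge-progression t c (offset u (toℕ y)) ≡ true → SamePair x y u w
  edge-progression-SamePair u w {t} {c} w≡ room d<n xy Ex Ey =
    [ (λ near → let (x₀ , yₜ) = edge-progression-Near {t} {c} near Ex Ey in inj₁ (at-0 x₀ , at-t yₜ)) ,
      (λ near → let (y₀ , xₜ) = edge-progression-Near {t} {c} near Ey Ex in inj₂ (at-t xₜ , at-0 y₀)) ]′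
      (circAdj-offset-Near u {edge-progression t c} (edge-progression-fits {t} {c} room d<n) xy Ex Ey)
    where
    at : ∀ {v : Fin n} {o} → offset u (toℕ v) ≡ o → toℕ v ≡ (toℕ u + o) % n
    at {v} eq = trans (sym (offset-inverse u v)) (cong (λ z → (toℕ u + z) % n) eq)
    at-0 : ∀ {v} → offset u (toℕ v) ≡ 0 → v ≡ u
    at-0 eq = toℕ-injective (trans (at eq) (trans (cong (_% n) (+-identityʳ _)) (m<n⇒m%n≡m (toℕ<n u))))
    at-t : ∀ {v} → offset u (toℕ v) ≡ t → v ≡ w
    at-t eq = toℕ-injective (trans (at eq) (sym w≡))

  edgeCritical-small : n ≤ 2 * d + 1 → EdgeCritical (C n d)
  edgeCritical-small small = edgeCritical 1 (λ _ → independence-≤-small small)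
    λ (a , b , ab) →
      endpoints a b , endpoints-independent (λ aa → proj₁ aa refl) ab , count-endpoints (proj₁ ab)

  edgeCritical-periodic : ∀ {c} → d < n → n ≡ d + c * suc d → EdgeCritical (C n d)
  edgeCritical-periodic {c} d<n n≡ = edgeCritical c (λ _ → independence-≤-periodic d<n n≡) larger
    where
    room : ∀ {t} → t ≤ d → t + c * suc d ≤ n
    room t≤d = ≤-trans (+-monoˡ-≤ (c * suc d) t≤d) (≤-reflexive (sym n≡))
    counted : ∀ u {t} → 1 ≤ t → t ≤ d → c < count (edge-progression t c ∘ offset u) n
    counted u 1≤t t≤d = subst (c <_) (sym (count-offset u _)) (count-edge-progression 1≤t (room t≤d))
    larger : ∀ e → Σ (ℕ → Bool) λ P → Independent (deleteEdge (C n d) e) P × c < count P n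
    larger (a , b , (_ , t , 1≤t , t≤d , inj₁ fwd)) =
      edge-progression t c ∘ offset a ,
      (λ x y (xy , ¬e) Ex Ey → ¬e (edge-progression-SamePair a b {t} {c} fwd (room t≤d) d<n xy Ex Ey)) ,
      counted a 1≤t t≤d
    larger (a , b , (_ , t , 1≤t , t≤d , inj₂ bwd)) =
      edge-progression t c ∘ offset b ,
      (λ x y (xy , ¬e) Ex Ey →
         ¬e (SamePair-swap (edge-progression-SamePair b a {t} {c} bwd (room t≤d) d<n xy Ex Ey))) ,
      counted b 1≤t t≤d

  module _ (1≤d : 1 ≤ d) (2d<n : d + d < n) where

    private
      d<n : d < n
      d<n = ≤-<-trans (m≤m+n d d) 2d<n
      0<n : 0 < n
      0<n = ≤-<-trans z≤n d<n

    e₀ : Edge (C n d)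
    e₀ = fromℕ< 0<n , fromℕ< d<n , close-adjacent 0<n d<n 1≤d ≤-refl

    private
      d+k≢0 : ∀ {k} → d + k ≢ 0
      d+k≢0 eq = <⇒≢ 1≤d (sym (m+n≡0⇒m≡0 d eq))

      adjacent-without-e₀ : ∀ {i j} (i<n : i < n) (j<n : j < n) → CircAdj n d (fromℕ< i<n) (fromℕ< j<n) →
        ¬ ((i ≡ 0 × j ≡ d) ⊎ (i ≡ d × j ≡ 0)) → Adj (deleteEdge (C n d) e₀) (fromℕ< i<n) (fromℕ< j<n)
      adjacent-without-e₀ _ _ adj ¬e₀ = adj , ¬e₀ ∘ fromℕ<-SamePair

    -- If 0 is marked, every other marked point lies in [d, n - d), where the marked points are
    -- linearly d-spaced.
    module _ {P} (indep : Independent (deleteEdge (C n d) e₀) P) (P0 : P 0 ≡ true) where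

      private
        L = n ∸ d
        d+L≡n : d + L ≡ n
        d+L≡n = m+[n∸m]≡n (<⇒≤ d<n)
        below-n : ∀ {k} → k < L → d + k < n
        below-n k<L = <-≤-trans (+-monoʳ-< d k<L) (≤-reflexive d+L≡n)

      count-below-d : count P d ≡ 1
      count-below-d = trans (count-vanish P 1≤d gap) (cong bit P0)
        where
        gap : ∀ {k} → 1 ≤ k → k < d → P k ≡ false
        gap {k} 1≤k k<d with P k in Pk
        ... | false = refl
        ... | true  = ⊥-elim (independent-fromℕ< {P = P} 0<n k<n indep P0 Pk
                        (adjacent-without-e₀ 0<n k<n (close-adjacent 0<n k<n 1≤k (<⇒≤ k<d))
                          λ { (inj₁ (_ , k≡d)) → <⇒≢ k<d k≡d ; (inj₂ (0≡d , _)) → <⇒≢ 1≤d 0≡d }))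
          where
          k<n : k < n
          k<n = <-trans k<d d<n

      spaced-beyond-d : Spaced d (P ∘ (d +_)) L
      spaced-beyond-d {i} {j} i<j j<L Pi Pj = ≰⇒> λ j≤i+d →
        independent-fromℕ< {P = P} d+i<n d+j<n indep Pi Pj
          (adjacent-without-e₀ d+i<n d+j<n (close-adjacent d+i<n d+j<n (+-monoʳ-< d i<j)
                         (subst (d + j ≤_) (sym (+-assoc d i d)) (+-monoʳ-≤ d j≤i+d)))
             λ { (inj₁ (d+i≡0 , _)) → d+k≢0 d+i≡0 ; (inj₂ (_ , d+j≡0)) → d+k≢0 d+j≡0 })
        where
        d+i<n = below-n (<-trans i<j j<L)
        d+j<n = below-n j<L

      bounded-beyond-d : ∀ {k} → k < L → P (d + k) ≡ true → k + d < L
      bounded-beyond-d {zero}  _   _  = m+n≤o⇒m≤o∸n (suc d) 2d<n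
      bounded-beyond-d {suc k} k<L Pk = m+n≤o⇒m≤o∸n (suc (suc k + d)) (subst (_≤ n) (shuffle d k) wrapped)
        where
        shuffle : ∀ d k → suc (d + suc k + d) ≡ suc (suc k + d) + d
        shuffle = solve-∀
        0<d+k : 0 < d + suc k
        0<d+k = ≤-trans (s≤s z≤n) (m≤n+m (suc k) d)
        wrapped : d + suc k + d < n
        wrapped = subst (d + suc k + d <_) (+-identityʳ n) (≰⇒> λ n≤ →
          independent-fromℕ< {P = P} (below-n k<L) 0<n indep Pk P0
            (adjacent-without-e₀ (below-n k<L) 0<n (wrap-adjacent 0<n (below-n k<L) 0<d+k n≤)
               λ { (inj₁ (d+k≡0 , _)) → d+k≢0 d+k≡0 ; (inj₂ (d+k≡d , _)) → m+1+n≢m d d+k≡d }))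

      count-≤-marked-0 : count P n * suc d ≤ suc n
      count-≤-marked-0 = begin
        count P n * suc d                             ≡⟨ cong (λ m → count P m * suc d) d+L≡n ⟨
        count P (d + L) * suc d                       ≡⟨ cong (_* suc d) (count-split P d L) ⟩
        (count P d + count (P ∘ (d +_)) L) * suc d    ≡⟨ cong (λ c → (c + count (P ∘ (d +_)) L) * suc d)
                                                            count-below-d ⟩
        suc d + count (P ∘ (d +_)) L * suc d          ≤⟨ +-monoʳ-≤ (suc d) (count-spaced d _ L L
                                                             spaced-beyond-d bounded-beyond-d) ⟩
        suc d + L                                     ≡⟨ cong suc d+L≡n ⟩
        suc n                                         ∎
        where open ≤-Reasoning

    count-≤-deleted : ∀ {P} → Independent (deleteEdge (C n d) e₀) P → count P n * suc d ≤ suc n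
    count-≤-deleted {P} indep with P 0 Bool.≟ true
    ... | yes P0 = count-≤-marked-0 indep P0
    ... | no ¬P0 = ≤-trans (count-cyclicallySpaced P d<n (cyclicallySpaced restored)) (n≤1+n n)
      where
      restored : Independent (C n d) P
      restored = independent-restore (proj₂ (proj₂ e₀)) {P} indep λ (P0 , _) →
        ¬P0 (subst (λ k → P k ≡ true) (toℕ-fromℕ< 0<n) P0)

    -- The q = n / (d + 1) multiples of d + 1 are independent in C n d, and since n % (d + 1) < d,
    -- the bound for C n d minus e₀ still only allows q marked points.
    ¬edgeCritical-remainder : n % suc d < d → ¬ EdgeCritical (C n d)
    ¬edgeCritical-remainder r<d = ¬edgeCritical e₀ {P} indep bound
      where
      q = n / suc d
      M = progression 0 (suc d) q
      P = M ∘ offset (fromℕ< 0<n)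
      fits : ∀ {o} → M o ≡ true → o + d < n
      fits {o} hit with progression-sound {0} {suc d} {q} {o} hit
      ... | i , i<q , refl = <-≤-trans (progression-gap 0 d i<q) (m/n*n≤m n (suc d))
      indep : Independent (C n d) P
      indep = independent-offset (fromℕ< 0<n) fits λ (i<j , j≤i+d) Mi Mj →
        <⇒≱ (progression-spaced {0} {d} {q} Mi Mj i<j) j≤i+d
      q≤count : q ≤ count P n
      q≤count = begin
        q                         ≤⟨ count-progression M 0 d q (progression-complete {0} {suc d} {q}) ⟩
        count M (q * suc d)       ≤⟨ count-mono M (m/n*n≤m n (suc d)) ⟩
        count M n                 ≡⟨ count-offset (fromℕ< 0<n) M ⟨
        count P n                 ∎
        where open ≤-Reasoning
      n<q+1 : suc n < suc q * suc d
      n<q+1 = begin-strict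
        suc n                      ≡⟨ cong suc (m≡m%n+[m/n]*n n (suc d)) ⟩
        suc (n % suc d) + q * suc d  <⟨ +-monoˡ-< (q * suc d) (s≤s r<d) ⟩
        suc d + q * suc d          ∎
        where open ≤-Reasoning
      bound : ∀ Q → Independent (deleteEdge (C n d) e₀) Q → count Q n ≤ count P n
      bound Q indepQ = ≤-trans
        (s≤s⁻¹ (*-cancelʳ-< (suc d) (count Q n) (suc q) (≤-<-trans (count-≤-deleted indepQ) n<q+1)))
        q≤count

theorem4 : (n d : ℕ) → .{{_ : NonZero n}} → 1 ≤ d →
    IsVCIrreducible (C n d) ⇔ (n ≤ 2 * d + 1 ⊎ suc d ∣ n ∸ d)
theorem4 n d 1≤d = mk⇔ necessary sufficient
  where
  open Circulant n d

  sufficient : n ≤ 2 * d + 1 ⊎ suc d ∣ n ∸ d → IsVCIrreducible (C n d)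
  sufficient (inj₁ small) = connected 1≤d , edgeCritical-small small
  sufficient (inj₂ (divides c n∸d≡c[d+1])) with d <? n
  ... | yes d<n = connected 1≤d , edgeCritical-periodic {c} d<n n≡d+c[d+1]
    where
    n≡d+c[d+1] : n ≡ d + c * suc d
    n≡d+c[d+1] = trans (sym (m+[n∸m]≡n (<⇒≤ d<n))) (cong (d +_) n∸d≡c[d+1])
  ... | no  d≮n = connected 1≤d , edgeCritical-small (≤-trans (≮⇒≥ d≮n) d≤2d+1)
    where
    d≤2d+1 : d ≤ 2 * d + 1
    d≤2d+1 = ≤-trans (m≤m+n d (d + 0)) (m≤m+n (2 * d) 1)

  necessary : IsVCIrreducible (C n d) → n ≤ 2 * d + 1 ⊎ suc d ∣ n ∸ d
  necessary (_ , critical) with n ≤? 2 * d + 1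
  ... | yes small = inj₁ small
  ... | no  large with n % suc d ≟ d
  ...   | yes r≡d = inj₂ (%≡⇒∣∸ r≡d)
  ...   | no  r≢d = ⊥-elim (¬edgeCritical-remainder 1≤d 2d<n r<d critical)
    where
    2d<n : d + d < n
    2d<n = <-trans (n<1+n (d + d)) (subst (_< n) (2*m+1≡1+m+m d) (≰⇒> large))
    r<d : n % suc d < d
    r<d = ≤∧≢⇒< (s≤s⁻¹ (m%n<n n (suc d))) r≢d
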